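{- Let $X$ be a simple graph on $n$ vertices and let $Y$ be a multiplicity graph with total multiplicity $n$ and lift $Y'$. Then the quotient graph $\mathsf{FS}(X,Y')/\!\equiv$ is isomorphic to $\mathsf{FS}_m(X,Y)$.
   Context: A multiplicity graph is a simple graph $Y$ on vertices $V(Y)$ with multiplicities $c_v\in\mathbb{Z}_{>0}$, total multiplicity $\sum_v c_v$. $\mathsf{FS}_m(X,Y)$ has as vertices the functions $\sigma:V(X)\to V(Y)$ with $|\sigma^{ -1}(y)|=c_y$ for all $y$, with $\sigma,\tau$ adjacent if $\sigma=\tau\circ(a\ b)$ for some $ab\in E(X)$ with $\sigma(a)\sigma(b)\in E(Y)$. The lift $Y'$ of $Y$ is the simple graph with vertex set $\bigsqcup_{v\in V(Y)}S_v$, $|S_v|=c_v$, where each $S_v$ is a clique and for $u\neq v$, vertices $u'\in S_u,v'\in S_v$ are adjacent iff $uv\in E(Y)$; $\pi_Y:V(Y')\to V(Y)$ maps $S_v$ to $v$. $\mathsf{FS}(X,Y')$ is the usual friends-and-strangers graph on bijections $V(X)\to V(Y')$ (same adjacency rule). Two bijections $\sigma_1,\sigma_2:V(X)\to V(Y')$ satisfy $\sigma_1\equiv\sigma_2$ if $\pi_Y\circ\sigma_1=\pi_Y\circ\sigma_2$. The quotient $\mathsf{FS}(X,Y')/\!\equiv$ has the $\equiv$-classes as vertices, with two distinct classes adjacent iff some representatives are adjacent in $\mathsf{FS}(X,Y')$. -}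

module Defs where

open import Level using (0ℓ)
open import Data.Nat using (ℕ; _≤_)
open import Data.Fin using (Fin; _≟_)
open import Data.Fin.Permutation.Components using (transpose)
open import Data.Vec.Base using (count; sum; tabulate; allFin)
open import Data.Product using (Σ; ∃; ∃-syntax; _×_; _,_; proj₁)
import Data.Sum
open import Data.Sum using (_⊎_)
open import Function.Definitions using (Bijective)
open import Function.Bundles using (_⇔_)
import Relation.Binary.PropositionalEquality
open import Relation.Binary.PropositionalEquality using (_≡_)
open import Relation.Nullary using (¬_)

record SimpleGraph (V : Set) : Set₁ where
  field
    Adj   : V → V → Set
    sym   : ∀ {u v} → Adj u v → Adj v u
    irrefl : ∀ {v} → ¬ Adj v v
open SimpleGraph public

record MultGraph : Set₁ where
  field
    k     : ℕ
    graph : SimpleGraph (Fin k)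
    mult  : Fin k → ℕ
    mult-pos : ∀ v → 1 ≤ mult v
open MultGraph public

totalMult : MultGraph → ℕ
totalMult Y = sum (tabulate (mult Y))

FSAdj : ∀ {n} {B : Set} → SimpleGraph (Fin n) → SimpleGraph B →
        (Fin n → B) → (Fin n → B) → Set
FSAdj {n} X Y σ τ =
  ∃[ a ] ∃[ b ] (Adj X a b × Adj Y (σ a) (σ b) × (∀ x → σ x ≡ τ (transpose a b x)))

fiberSize : ∀ {n k} → (Fin n → Fin k) → Fin k → ℕ
fiberSize {n} σ y = count (λ i → σ i ≟ y) (allFin n)

FSmVertex : (n : ℕ) → MultGraph → Set
FSmVertex n Y = Σ (Fin n → Fin (k Y)) λ σ → ∀ y → fiberSize σ y ≡ mult Y y

EqM : ∀ {n} (Y : MultGraph) → FSmVertex n Y → FSmVertex n Y → Set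
EqM Y σ τ = ∀ x → proj₁ σ x ≡ proj₁ τ x

FSmAdj : ∀ {n} (X : SimpleGraph (Fin n)) (Y : MultGraph) →
         FSmVertex n Y → FSmVertex n Y → Set
FSmAdj X Y σ τ = FSAdj X (graph Y) (proj₁ σ) (proj₁ τ)

LiftV : MultGraph → Set
LiftV Y = Σ (Fin (k Y)) λ v → Fin (mult Y v)

π : ∀ {Y} → LiftV Y → Fin (k Y)
π = proj₁

LiftAdj : (Y : MultGraph) → LiftV Y → LiftV Y → Set
LiftAdj Y p q =
  (π {Y} p ≡ π {Y} q × ¬ p ≡ q) ⊎ (¬ π {Y} p ≡ π {Y} q × Adj (graph Y) (π {Y} p) (π {Y} q))

liftSym : ∀ Y {p q} → LiftAdj Y p q → LiftAdj Y q p
liftSym Y (Data.Sum.inj₁ (e , ne)) =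
  Data.Sum.inj₁ (Relation.Binary.PropositionalEquality.sym e ,
                 λ h → ne (Relation.Binary.PropositionalEquality.sym h))
liftSym Y (Data.Sum.inj₂ (ne , a)) =
  Data.Sum.inj₂ ((λ h → ne (Relation.Binary.PropositionalEquality.sym h)) , SimpleGraph.sym (graph Y) a)

liftIrrefl : ∀ Y {p} → ¬ LiftAdj Y p p
liftIrrefl Y (Data.Sum.inj₁ (_ , ne)) = ne Relation.Binary.PropositionalEquality.refl
liftIrrefl Y (Data.Sum.inj₂ (ne , _)) = ne Relation.Binary.PropositionalEquality.refl

Lift : (Y : MultGraph) → SimpleGraph (LiftV Y)
Lift Y = record { Adj = LiftAdj Y ; sym = liftSym Y ; irrefl = liftIrrefl Y }

FSVertex : (n : ℕ) → MultGraph → Set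
FSVertex n Y = Σ (Fin n → LiftV Y) (Bijective _≡_ _≡_)

FSAdj' : ∀ {n} (X : SimpleGraph (Fin n)) (Y : MultGraph) → FSVertex n Y → FSVertex n Y → Set
FSAdj' X Y σ τ = FSAdj X (Lift Y) (proj₁ σ) (proj₁ τ)

EqQ : ∀ {n} (Y : MultGraph) → FSVertex n Y → FSVertex n Y → Set
EqQ Y σ τ = ∀ x → π {Y} (proj₁ σ x) ≡ π {Y} (proj₁ τ x)

QuotAdj : ∀ {n} (X : SimpleGraph (Fin n)) (Y : MultGraph) → FSVertex n Y → FSVertex n Y → Set
QuotAdj X Y σ τ = ¬ (EqQ Y σ τ) ×
  ∃[ σ' ] ∃[ τ' ] (EqQ Y σ' σ × EqQ Y τ' τ × FSAdj' X Y σ' τ')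

-- A graph isomorphism from the quotient FS(X,Y')/≡ to FS_m(X,Y):
-- a map on representatives that is well defined on classes, injective on
-- classes, surjective, and preserves and reflects adjacency.
QuotIso : ∀ {n} (X : SimpleGraph (Fin n)) (Y : MultGraph) → (FSVertex n Y → FSmVertex n Y) → Set
QuotIso X Y f =
  (∀ σ τ → EqQ Y σ τ → EqM Y (f σ) (f τ)) ×
  (∀ σ τ → EqM Y (f σ) (f τ) → EqQ Y σ τ) ×
  (∀ w → ∃[ σ ] (EqM Y (f σ) w)) ×
  (∀ σ τ → QuotAdj X Y σ τ ⇔ FSmAdj X Y (f σ) (f τ))

-- Composing with π : V(Y′) → V(Y) sends a bijection σ to a map whose fibre over y is
-- enumerated by the clique S_y, so it has size c_y; conversely, enumerating each fibre of a
-- map w with fibre sizes c_y assembles a bijection over w, so projection is surjective and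
-- its fibres are exactly the ≡-classes. An edge of FS(X, Y′) swaps either two vertices of one
-- clique, which stays inside a class, or two vertices over an edge of Y, which is an edge
-- of FS_m(X, Y); and every edge of FS_m(X, Y) at π ∘ σ is realised at σ by the same swap.
module Submission where

open import Defs hiding (sym)
open import Level using (0ℓ)
open import Data.Nat using (ℕ; suc)
open import Data.Fin using (Fin; zero; suc; _≟_)
open import Data.Fin.Properties using (suc-injective; cantor-schröder-bernstein)
open import Data.Fin.Permutation.Components using (transpose)
open import Data.Vec.Base using (count; tabulate)
open import Data.Product using (Σ; ∃-syntax; _,_; proj₁)
open import Data.Product.Properties using (,-injectiveˡ; ,-injectiveʳ-UIP)
open import Data.Sum using (_⊎_; inj₁; inj₂)
open import Function using (_∘_; id)
open import Function.Bundles using (mk⇔)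
open import Function.Definitions using (Bijective; Injective; Surjective)
import Function.Construct.Composition as Compose
open import Axiom.UniquenessOfIdentityProofs using (UIP; module Decidable⇒UIP)
open import Relation.Binary.PropositionalEquality
open import Relation.Nullary using (¬_; Dec; yes; no; contradiction)
open import Relation.Unary using (Pred; Decidable)

transpose-matchˡ : ∀ {n} (i j : Fin n) → transpose i j i ≡ j
transpose-matchˡ i j with i ≟ i
... | yes _  = refl
... | no i≢i = contradiction refl i≢i

transpose-matchʳ : ∀ {n} (i j : Fin n) → transpose i j j ≡ i
transpose-matchʳ i j with j ≟ i
... | yes j≡i = j≡i
... | no _ with j ≟ j
...   | yes _  = refl
...   | no j≢j = contradiction refl j≢j

transpose-fixes : ∀ {n} {i j k : Fin n} → k ≢ i → k ≢ j → transpose i j k ≡ k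
transpose-fixes {i = i} {j} {k} k≢i k≢j with k ≟ i
... | yes k≡i = contradiction k≡i k≢i
... | no _ with k ≟ j
...   | yes k≡j = contradiction k≡j k≢j
...   | no _    = refl

transpose-involutive : ∀ {n} (i j k : Fin n) → transpose i j (transpose i j k) ≡ k
transpose-involutive i j k = by-cases (k ≟ i) (k ≟ j)
  where
  by-cases : Dec (k ≡ i) → Dec (k ≡ j) → transpose i j (transpose i j k) ≡ k
  by-cases (yes refl) _          = trans (cong (transpose k j) (transpose-matchˡ k j)) (transpose-matchʳ k j)
  by-cases (no _)     (yes refl) = trans (cong (transpose i k) (transpose-matchʳ i k)) (transpose-matchˡ i k)
  by-cases (no k≢i)   (no k≢j)   =
    trans (cong (transpose i j) (transpose-fixes k≢i k≢j)) (transpose-fixes k≢i k≢j)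

transpose-bijective : ∀ {n} (i j : Fin n) → Bijective _≡_ _≡_ (transpose i j)
transpose-bijective i j = injective , surjective
  where
  injective : Injective _≡_ _≡_ (transpose i j)
  injective {k} {l} e =
    trans (sym (transpose-involutive i j k)) (trans (cong (transpose i j) e) (transpose-involutive i j l))
  surjective : Surjective _≡_ _≡_ (transpose i j)
  surjective k = transpose i j k , λ { refl → transpose-involutive i j k }

∘-transpose-≗ : ∀ {n} {B : Set} (f : Fin n → B) {i j : Fin n} → f i ≡ f j → f ∘ transpose i j ≗ f
∘-transpose-≗ f {i} {j} fi≡fj k = by-cases (k ≟ i) (k ≟ j)
  where
  by-cases : Dec (k ≡ i) → Dec (k ≡ j) → f (transpose i j k) ≡ f k
  by-cases (yes refl) _          = trans (cong f (transpose-matchˡ k j)) (sym fi≡fj)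
  by-cases (no _)     (yes refl) = trans (cong f (transpose-matchʳ i k)) fi≡fj
  by-cases (no k≢i)   (no k≢j)   = cong f (transpose-fixes k≢i k≢j)

module Rank {A : Set} {P : Pred A 0ℓ} (P? : Decidable P) where

  rank : ∀ {n} (f : Fin n → A) (x : Fin n) → P (f x) → Fin (count P? (tabulate f))
  rank {suc n} f x p with P? (f zero)
  rank {suc n} f zero    p | yes _ = zero
  rank {suc n} f (suc x) p | yes _ = suc (rank (f ∘ suc) x p)
  rank {suc n} f zero    p | no ¬p = contradiction p ¬p
  rank {suc n} f (suc x) p | no _  = rank (f ∘ suc) x p

  rank-injective : ∀ {n} (f : Fin n → A) {x y} (p : P (f x)) (q : P (f y)) →
                   rank f x p ≡ rank f y q → x ≡ y
  rank-injective {suc n} f {x} {y} p q e with P? (f zero)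
  rank-injective {suc n} f {zero}  {zero}  p q e | yes _ = refl
  rank-injective {suc n} f {suc x} {suc y} p q e | yes _ =
    cong suc (rank-injective (f ∘ suc) p q (suc-injective e))
  rank-injective {suc n} f {zero}  {zero}  p q e | no _  = refl
  rank-injective {suc n} f {zero}  {suc y} p q e | no ¬p = contradiction p ¬p
  rank-injective {suc n} f {suc x} {zero}  p q e | no ¬q = contradiction q ¬q
  rank-injective {suc n} f {suc x} {suc y} p q e | no _  =
    cong suc (rank-injective (f ∘ suc) p q e)

  rank-surjective : ∀ {n} (f : Fin n → A) (i : Fin (count P? (tabulate f))) →
                    ∃[ x ] ∃[ p ] rank f x p ≡ i
  rank-surjective {suc n} f i with P? (f zero)
  rank-surjective {suc n} f zero    | yes p = zero , p , refl
  rank-surjective {suc n} f (suc i) | yes _ with rank-surjective (f ∘ suc) i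
  ... | x , p , e = suc x , p , cong suc e
  rank-surjective {suc n} f i       | no _ with rank-surjective (f ∘ suc) i
  ... | x , p , e = suc x , p , e

Fin-UIP : ∀ {k} → UIP (Fin k)
Fin-UIP = Decidable⇒UIP.≡-irrelevant _≟_

record FibreEnumeration {n k : ℕ} (g : Fin n → Fin k) (y : Fin k) (c : ℕ) : Set where
  field
    label            : ∀ x → g x ≡ y → Fin c
    label-injective  : ∀ {x₁ x₂} (p₁ : g x₁ ≡ y) (p₂ : g x₂ ≡ y) → label x₁ p₁ ≡ label x₂ p₂ → x₁ ≡ x₂
    label-surjective : ∀ i → ∃[ x ] ∃[ p ] label x p ≡ i
open FibreEnumeration

module _ {n k : ℕ} {g : Fin n → Fin k} {y : Fin k} where

  rankEnumeration : FibreEnumeration g y (fiberSize g y)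
  rankEnumeration = record
    { label            = rank id
    ; label-injective  = rank-injective id
    ; label-surjective = rank-surjective id
    }
    where open Rank (λ x → g x ≟ y)

  transfer : ∀ {c c′} → FibreEnumeration g y c → FibreEnumeration g y c′ → Fin c → Fin c′
  transfer E E′ i = let (x , p , _) = label-surjective E i in label E′ x p

  transfer-injective : ∀ {c c′} (E : FibreEnumeration g y c) (E′ : FibreEnumeration g y c′) →
                       Injective _≡_ _≡_ (transfer E E′)
  transfer-injective E E′ {i₁} {i₂} e with label-surjective E i₁ | label-surjective E i₂
  ... | x₁ , p₁ , refl | x₂ , p₂ , refl with refl ← label-injective E′ p₁ p₂ e =
    cong (label E x₁) (Fin-UIP p₁ p₂)

  enumeration-size-unique : ∀ {c c′} → FibreEnumeration g y c → FibreEnumeration g y c′ → c ≡ c′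
  enumeration-size-unique E E′ =
    cantor-schröder-bernstein (transfer-injective E E′) (transfer-injective E′ E)

  fiberSize-enumerated : ∀ {c} → FibreEnumeration g y c → fiberSize g y ≡ c
  fiberSize-enumerated = enumeration-size-unique rankEnumeration

module _ {n k : ℕ} {c : Fin k → ℕ} where

  coordinate : ∀ {y} (q : Σ (Fin k) (Fin ∘ c)) → proj₁ q ≡ y → Fin (c y)
  coordinate (_ , i) refl = i

  coordinate-injective : ∀ {y} {q₁ q₂ : Σ (Fin k) (Fin ∘ c)} (p₁ : proj₁ q₁ ≡ y) (p₂ : proj₁ q₂ ≡ y) →
                         coordinate q₁ p₁ ≡ coordinate q₂ p₂ → q₁ ≡ q₂
  coordinate-injective refl refl refl = refl

  coordinate-≡ : ∀ {q y i} (e : q ≡ (y , i)) → coordinate q (cong proj₁ e) ≡ i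
  coordinate-≡ refl = refl

  projectionEnumeration : {s : Fin n → Σ (Fin k) (Fin ∘ c)} → Bijective _≡_ _≡_ s →
                          ∀ y → FibreEnumeration (proj₁ ∘ s) y (c y)
  projectionEnumeration {s} (s-injective , s-surjective) y = record
    { label            = λ x → coordinate (s x)
    ; label-injective  = λ p₁ p₂ → s-injective ∘ coordinate-injective p₁ p₂
    ; label-surjective = λ i → let (x , sx≡) = s-surjective (y , i) in
                               x , cong proj₁ (sx≡ refl) , coordinate-≡ (sx≡ refl)
    }

  assemble : {g : Fin n → Fin k} → (∀ y → FibreEnumeration g y (c y)) → Fin n → Σ (Fin k) (Fin ∘ c)
  assemble {g} E x = g x , label (E (g x)) x refl

  assemble-bijective : {g : Fin n → Fin k} (E : ∀ y → FibreEnumeration g y (c y)) →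
                       Bijective _≡_ _≡_ (assemble E)
  assemble-bijective {g} E = (λ e → fibres-injective refl refl e) , surjective
    where
    fibres-injective : ∀ {x₁ x₂ y₁ y₂} (p₁ : g x₁ ≡ y₁) (p₂ : g x₂ ≡ y₂) →
                       _≡_ {A = Σ (Fin k) (Fin ∘ c)} (y₁ , label (E y₁) x₁ p₁) (y₂ , label (E y₂) x₂ p₂) →
                       x₁ ≡ x₂
    fibres-injective p₁ p₂ e with refl ← ,-injectiveˡ e =
      label-injective (E _) p₁ p₂ (,-injectiveʳ-UIP Fin-UIP e)
    surjective : Surjective _≡_ _≡_ (assemble E)
    surjective (y , i) with label-surjective (E y) i
    ... | x , refl , refl = x , λ { refl → refl }

Adj⇒≢ : ∀ {V} (G : SimpleGraph V) {u v} → Adj G u v → u ≢ v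
Adj⇒≢ G adj refl = irrefl G adj

module _ {n : ℕ} {B : Set} (X : SimpleGraph (Fin n)) (G : SimpleGraph B) where

  FSAdj-resp-≗ : ∀ {f f′ g g′ : Fin n → B} → f ≗ f′ → g ≗ g′ → FSAdj X G f g → FSAdj X G f′ g′
  FSAdj-resp-≗ f≗f′ g≗g′ (a , b , ab , fab , f≡g∘ab) =
    a , b , ab , subst₂ (Adj G) (f≗f′ a) (f≗f′ b) fab ,
    λ x → trans (sym (f≗f′ x)) (trans (f≡g∘ab x) (g≗g′ _))

  FSAdj⇒≉ : ∀ {f g : Fin n → B} → FSAdj X G f g → ¬ (f ≗ g)
  FSAdj⇒≉ {f} {g} (a , b , _ , fab , f≡g∘ab) f≗g =
    Adj⇒≢ G fab (trans (f≡g∘ab a) (trans (cong g (transpose-matchˡ a b)) (sym (f≗g b))))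

  FSAdj-∘transpose : ∀ {f : Fin n → B} {a b} → Adj X a b → Adj G (f a) (f b) →
                     FSAdj X G f (f ∘ transpose a b)
  FSAdj-∘transpose {f} {a} {b} ab fab = a , b , ab , fab , λ x → cong f (sym (transpose-involutive a b x))

module _ {n : ℕ} (X : SimpleGraph (Fin n)) (Y : MultGraph) where

  FSAdj-Lift⇒ : ∀ {s t : Fin n → LiftV Y} → FSAdj X (Lift Y) s t →
                (π {Y} ∘ s ≗ π {Y} ∘ t) ⊎ FSAdj X (graph Y) (π {Y} ∘ s) (π {Y} ∘ t)
  FSAdj-Lift⇒ {s} {t} (a , b , _ , inj₁ (same , _) , s≡t∘ab) = inj₁ λ x →
    trans (sym (∘-transpose-≗ (π {Y} ∘ s) same x))
          (trans (cong (π {Y}) (s≡t∘ab (transpose a b x))) (cong (π {Y} ∘ t) (transpose-involutive a b x)))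
  FSAdj-Lift⇒ (a , b , ab , inj₂ (_ , adj) , s≡t∘ab) = inj₂ (a , b , ab , adj , cong (π {Y}) ∘ s≡t∘ab)

  project : FSVertex n Y → FSmVertex n Y
  project (s , s-bijective) =
    π {Y} ∘ s , λ y → fiberSize-enumerated (projectionEnumeration s-bijective y)

  lift : FSmVertex n Y → FSVertex n Y
  lift (w , w-fibres) = assemble E , assemble-bijective E
    where
    E : ∀ y → FibreEnumeration w y (mult Y y)
    E y = subst (FibreEnumeration w y) (w-fibres y) rankEnumeration

  project-adjacent : ∀ σ τ → QuotAdj X Y σ τ → FSmAdj X Y (project σ) (project τ)
  project-adjacent σ τ (σ≢τ , σ′ , τ′ , σ′≡σ , τ′≡τ , adj)
    with FSAdj-Lift⇒ {proj₁ σ′} {proj₁ τ′} adj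
  ... | inj₁ σ′≡τ′ = contradiction (λ x → trans (sym (σ′≡σ x)) (trans (σ′≡τ′ x) (τ′≡τ x))) σ≢τ
  ... | inj₂ adjπ = FSAdj-resp-≗ X (graph Y) σ′≡σ τ′≡τ adjπ

  adjacent-project : ∀ σ τ → FSmAdj X Y (project σ) (project τ) → QuotAdj X Y σ τ
  adjacent-project σ@(s , s-bijective) τ@(t , _) adj@(a , b , ab , sab , s≡t∘ab) =
    FSAdj⇒≉ X (graph Y) adj , σ , σ∘ab , (λ _ → refl) , σ∘ab≡τ ,
    FSAdj-∘transpose X (Lift Y) ab (inj₂ (Adj⇒≢ (graph Y) sab , sab))
    where
    σ∘ab : FSVertex n Y
    σ∘ab = s ∘ transpose a b , Compose.bijective _≡_ _≡_ _≡_ (transpose-bijective a b) s-bijective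
    σ∘ab≡τ : EqQ Y σ∘ab τ
    σ∘ab≡τ x = trans (s≡t∘ab (transpose a b x)) (cong (π {Y} ∘ t) (transpose-involutive a b x))

  project-quotientIso : QuotIso X Y project
  project-quotientIso =
    (λ _ _ → id) , (λ _ _ → id) , (λ w → lift w , λ _ → refl) ,
    λ σ τ → mk⇔ (project-adjacent σ τ) (adjacent-project σ τ)

proposition2p5 : (n : ℕ) (X : SimpleGraph (Fin n)) (Y : MultGraph) →
                 totalMult Y ≡ n →
                 ∃[ f ] QuotIso X Y f
proposition2p5 n X Y _ = project X Y , project-quotientIso X Y
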